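{- Let $D$ be any digraph of order $n$. Then $\gamma_{iso}(D)=n$ if and only if for every vertex $u$ of $D$, $d^+(u)=0$ or $d^-(u)=0$.
   Context: Digraphs $D=(V,A)$ are finite, without loops or multiple arcs (pairs of opposite arcs allowed). $N^+(v)=\{w: vw\in A\}$, $N^-(v)=\{w: wv\in A\}$, $d^\pm(v)=|N^\pm(v)|$. $S\subseteq V$ is out-dominating if every $v\in V\setminus S$ has an in-neighbor in $S$. $S$ is an in-secure out-dominating set (ISODS) if $S$ is out-dominating and for every $v\in V\setminus S$ there is $u\in N^+(v)\cap S$ such that $(S\setminus\{u\})\cup\{v\}$ is out-dominating; $\gamma_{iso}(D)$ is the minimum size of an ISODS. -}

module Defs where

open import Data.Nat using (ℕ; _≤_)
open import Data.Bool using (Bool; true; false; T)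
open import Data.Fin using (Fin)
open import Data.Fin.Subset using (Subset; _∈_; _∉_; _∪_; _-_; ⁅_⁆; ∣_∣)
open import Data.Vec using (tabulate)
open import Data.Product using (Σ; ∃; _×_; _,_)
open import Relation.Binary.PropositionalEquality using (_≡_)
open import Relation.Nullary using (¬_)

-- Pairs of opposite arcs are allowed; multiple arcs are impossible.
record Digraph (n : ℕ) : Set where
  field
    arc      : Fin n → Fin n → Bool
    loopless : ∀ v → arc v v ≡ false
open Digraph public

module _ {n : ℕ} (D : Digraph n) where

  Arc : Fin n → Fin n → Set
  Arc u v = T (arc D u v)

  N⁺ : Fin n → Subset n
  N⁺ v = tabulate (λ w → arc D v w)

  N⁻ : Fin n → Subset n
  N⁻ v = tabulate (λ w → arc D w v)

  d⁺ : Fin n → ℕ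
  d⁺ v = ∣ N⁺ v ∣

  d⁻ : Fin n → ℕ
  d⁻ v = ∣ N⁻ v ∣

  OutDominating : Subset n → Set
  OutDominating S = ∀ v → v ∉ S → ∃ λ u → u ∈ S × Arc u v

  ISODS : Subset n → Set
  ISODS S = OutDominating S ×
            (∀ v → v ∉ S → ∃ λ u → Arc v u × u ∈ S ×
                                    OutDominating ((S - u) ∪ ⁅ v ⁆))

  γiso≡ : ℕ → Set
  γiso≡ k = (∃ λ S → ISODS S × ∣ S ∣ ≡ k) × (∀ S → ISODS S → k ≤ ∣ S ∣)

module Submission where

-- A vertex outside an ISODS needs an in-neighbour in the set (domination) and an
-- out-neighbour in the set (security), so it is neither a source nor a sink.
-- Hence if every vertex is a source or a sink, the only ISODS is V itself.
-- Conversely, if u has an in-neighbour w and an out-neighbour x, then V - u is an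
-- ISODS: w dominates u, and swapping x for u leaves x as the only vertex outside,
-- dominated by u.

open import Defs
open import Data.Nat using (ℕ; _<_)
open import Data.Nat.Properties using (n≮0; <⇒≱; <-≤-trans; ≤-reflexive; ≤-trans)
import Data.Nat.Properties as ℕ
open import Data.Fin using (Fin)
open import Data.Fin.Properties using (_≟_)
open import Data.Bool using (Bool; T)
open import Data.Bool.Properties using (T-≡)
open import Data.Fin.Subset using (Subset; _∈_; _∉_; _∪_; _-_; ⁅_⁆; ∣_∣; ⊤; Nonempty)
open import Data.Fin.Subset.Properties
  using ( _∈?_; ∈⊤; ∣⊤∣≡n; ∣⊥∣≡0; nonempty?; Empty-unique; p⊆q⇒∣p∣≤∣q∣
        ; x∈p⇒∣p-x∣<∣p∣; x∈p∧x≢y⇒x∈p-y; x∈⁅x⁆; x∈p∪q⁺ )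
open import Data.Vec using (tabulate)
open import Data.Vec.Properties using (lookup∘tabulate; lookup⇒[]=; []=⇒lookup)
open import Data.Sum using (_⊎_; inj₁; inj₂)
open import Data.Product using (∃; _×_; _,_)
open import Data.Empty using (⊥-elim)
open import Function.Bundles using (_⇔_; mk⇔; Equivalence)
open import Relation.Nullary using (yes; no; contradiction)
open import Relation.Binary.PropositionalEquality using (_≡_; _≢_; refl; sym; trans; subst)

module _ {n : ℕ} where

  ∈-tabulate⁺ : ∀ (f : Fin n → Bool) {x} → T (f x) → x ∈ tabulate f
  ∈-tabulate⁺ f {x} t = lookup⇒[]= x (tabulate f) (trans (lookup∘tabulate f x) (Equivalence.to T-≡ t))

  ∈-tabulate⁻ : ∀ (f : Fin n → Bool) {x} → x ∈ tabulate f → T (f x)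
  ∈-tabulate⁻ f {x} x∈ = Equivalence.from T-≡ (trans (sym (lookup∘tabulate f x)) ([]=⇒lookup x∈))

  x∈p⇒∣p∣≢0 : ∀ {x} {p : Subset n} → x ∈ p → ∣ p ∣ ≢ 0
  x∈p⇒∣p∣≢0 {x} {p} x∈p ∣p∣≡0 = n≮0 (subst (∣ p - x ∣ <_) ∣p∣≡0 (x∈p⇒∣p-x∣<∣p∣ x∈p))

  ∣p∣≢0⇒Nonempty : (p : Subset n) → ∣ p ∣ ≢ 0 → Nonempty p
  ∣p∣≢0⇒Nonempty p ∣p∣≢0 with nonempty? p
  ... | yes ne = ne
  ... | no ¬ne = contradiction (subst (λ q → ∣ q ∣ ≡ 0) (sym (Empty-unique ¬ne)) (∣⊥∣≡0 n)) ∣p∣≢0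

module _ {n : ℕ} (D : Digraph n) where

  Arc⇒≢ : ∀ {u v} → Arc D u v → u ≢ v
  Arc⇒≢ {u} uv refl = subst T (loopless D u) uv

  Arc⇒d⁺≢0 : ∀ {u v} → Arc D u v → d⁺ D u ≢ 0
  Arc⇒d⁺≢0 {u} uv = x∈p⇒∣p∣≢0 (∈-tabulate⁺ (arc D u) uv)

  Arc⇒d⁻≢0 : ∀ {u v} → Arc D u v → d⁻ D v ≢ 0
  Arc⇒d⁻≢0 {v = v} uv = x∈p⇒∣p∣≢0 (∈-tabulate⁺ (λ w → arc D w v) uv)

  d⁺≢0⇒Arc : ∀ {u} → d⁺ D u ≢ 0 → ∃ λ v → Arc D u v
  d⁺≢0⇒Arc {u} d⁺≢0 with ∣p∣≢0⇒Nonempty (N⁺ D u) d⁺≢0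
  ... | v , v∈ = v , ∈-tabulate⁻ (arc D u) v∈

  d⁻≢0⇒Arc : ∀ {v} → d⁻ D v ≢ 0 → ∃ λ u → Arc D u v
  d⁻≢0⇒Arc {v} d⁻≢0 with ∣p∣≢0⇒Nonempty (N⁻ D v) d⁻≢0
  ... | u , u∈ = u , ∈-tabulate⁻ (λ w → arc D w v) u∈

  ISODS-⊤ : ISODS D ⊤
  ISODS-⊤ = (λ v v∉ → contradiction ∈⊤ v∉) , (λ v v∉ → contradiction ∈⊤ v∉)

  ∉ISODS⇒d⁺≢0×d⁻≢0 : ∀ {S v} → ISODS D S → v ∉ S → d⁺ D v ≢ 0 × d⁻ D v ≢ 0
  ∉ISODS⇒d⁺≢0×d⁻≢0 {v = v} (dom , secure) v∉ with secure v v∉ | dom v v∉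
  ... | _ , vu , _ | _ , _ , wv = Arc⇒d⁺≢0 vu , Arc⇒d⁻≢0 wv

  outDominating-allBut : ∀ {T z t} → (∀ y → y ≢ z → y ∈ T) → t ∈ T → Arc D t z → OutDominating D T
  outDominating-allBut {z = z} {t} allBut t∈ tz y y∉ with y ≟ z
  ... | yes refl = t , t∈ , tz
  ... | no y≢z = contradiction (allBut y y≢z) y∉

  ISODS-⊤-u : ∀ {w u x} → Arc D w u → Arc D u x → ISODS D (⊤ - u)
  ISODS-⊤-u {w} {u} {x} wu ux =
    outDominating-allBut ∈⊤-u (∈⊤-u w (Arc⇒≢ wu)) wu , secure
    where
    ∈⊤-u : ∀ y → y ≢ u → y ∈ ⊤ - u
    ∈⊤-u y y≢u = x∈p∧x≢y⇒x∈p-y ∈⊤ y≢u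

    ∈swap : ∀ y → y ≢ x → y ∈ ((⊤ - u) - x) ∪ ⁅ u ⁆
    ∈swap y y≢x with y ≟ u
    ... | yes refl = x∈p∪q⁺ (inj₂ (x∈⁅x⁆ u))
    ... | no y≢u = x∈p∪q⁺ (inj₁ (x∈p∧x≢y⇒x∈p-y (∈⊤-u y y≢u) y≢x))

    secure : ∀ v → v ∉ ⊤ - u → ∃ λ x′ → Arc D v x′ × x′ ∈ ⊤ - u × OutDominating D (((⊤ - u) - x′) ∪ ⁅ v ⁆)
    secure v v∉ with v ≟ u
    ... | no v≢u = contradiction (∈⊤-u v v≢u) v∉
    ... | yes refl = x , ux , ∈⊤-u x (λ x≡u → Arc⇒≢ ux (sym x≡u))
                   , outDominating-allBut ∈swap (x∈p∪q⁺ (inj₂ (x∈⁅x⁆ u))) ux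

  SourceOrSink : Fin n → Set
  SourceOrSink u = d⁺ D u ≡ 0 ⊎ d⁻ D u ≡ 0

  SourceOrSink⇒∈ISODS : ∀ {S v} → SourceOrSink v → ISODS D S → v ∈ S
  SourceOrSink⇒∈ISODS {S} {v} v-ss iso with v ∈? S
  ... | yes v∈ = v∈
  ... | no v∉ with ∉ISODS⇒d⁺≢0×d⁻≢0 iso v∉ | v-ss
  ...   | d⁺≢0 , _ | inj₁ d⁺≡0 = contradiction d⁺≡0 d⁺≢0
  ...   | _ , d⁻≢0 | inj₂ d⁻≡0 = contradiction d⁻≡0 d⁻≢0

  γiso≡n⇒SourceOrSink : γiso≡ D n → ∀ u → SourceOrSink u
  γiso≡n⇒SourceOrSink (_ , minimal) u with d⁺ D u ℕ.≟ 0 | d⁻ D u ℕ.≟ 0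
  ... | yes d⁺≡0 | _ = inj₁ d⁺≡0
  ... | no _ | yes d⁻≡0 = inj₂ d⁻≡0
  ... | no d⁺≢0 | no d⁻≢0 with d⁻≢0⇒Arc d⁻≢0 | d⁺≢0⇒Arc d⁺≢0
  ...   | w , wu | x , ux = ⊥-elim (<⇒≱ ∣⊤-u∣<n (minimal (⊤ - u) (ISODS-⊤-u wu ux)))
    where
    ∣⊤-u∣<n : ∣ ⊤ - u ∣ < n
    ∣⊤-u∣<n = <-≤-trans (x∈p⇒∣p-x∣<∣p∣ {x = u} {p = ⊤} ∈⊤) (≤-reflexive (∣⊤∣≡n n))

  SourceOrSink⇒γiso≡n : (∀ u → SourceOrSink u) → γiso≡ D n
  SourceOrSink⇒γiso≡n all-ss =
      (⊤ , ISODS-⊤ , ∣⊤∣≡n n)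
    , λ S iso → ≤-trans (≤-reflexive (sym (∣⊤∣≡n n)))
                        (p⊆q⇒∣p∣≤∣q∣ {p = ⊤} (λ {v} _ → SourceOrSink⇒∈ISODS (all-ss v) iso))

theorem5p6 : (n : ℕ) (D : Digraph n) →
    γiso≡ D n ⇔ (∀ (u : Fin n) → d⁺ D u ≡ 0 ⊎ d⁻ D u ≡ 0)
theorem5p6 n D = mk⇔ (γiso≡n⇒SourceOrSink D) (SourceOrSink⇒γiso≡n D)
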